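{- Let $\langle\mathbf{A},m\rangle$ be a monotonic distributive semilattice. Then the map $\beta\colon A\to D(X(\mathbf{A}))$, $\beta(a)=\{P\in X(\mathbf{A}):a\in P\}$, is an isomorphism of monotonic distributive semilattices from $\langle\mathbf{A},m\rangle$ onto $\langle D(X(\mathbf{A})),\cap,m_{R_m},X(\mathbf{A})\rangle$.
   Context: A semilattice is $\langle A,\wedge,1\rangle$ with $\wedge$ idempotent, commutative, associative and $a\wedge1=a$; natural order $a\le b$ iff $a\wedge b=a$. A filter is an upset containing $1$ closed under $\wedge$; irreducible if proper and $F=F_1\cap F_2$ (filters) implies $F=F_1$ or $F=F_2$. $\mathbf{A}$ is distributive if $a\wedge b\le c$ implies $c=a_1\wedge b_1$ for some $a_1\ge a,b_1\ge b$. A monotonic distributive semilattice is $\langle\mathbf{A},m\rangle$ with $\mathbf{A}$ distributive and $m$ order-preserving; homomorphisms preserve $\wedge$, $1$ and commute with $m$. $X(\mathbf{A})$ is the set of irreducible filters with the topology generated by $\{X(\mathbf{A})-\beta(a):a\in A\}$. For a topological space $X$: $\mathcal{KO}(X)$ compact open subsets, $D(X)=\{U:X-U\in\mathcal{KO}(X)\}$, $\mathcal{S}(X)$ the set of all $\bigcap\mathcal{L}$ for dually directed (under inclusion) $\mathcal{L}\subseteq\mathcal{KO}(X)$. $m^{ -1}(P)=\{a:ma\in P\}$, $I_{\mathbf{A}}(Z)=\{a:\beta(a)\cap Z=\emptyset\}$; $(P,Z)\in R_m$ iff $m^{ -1}(P)\cap I_{\mathbf{A}}(Z)=\emptyset$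 ($P\in X(\mathbf{A}),Z\in\mathcal{S}(X(\mathbf{A}))$); $m_{R_m}(U)=\{P:\forall Z\,((P,Z)\in R_m\Rightarrow Z\cap U\ne\emptyset)\}$. -}

module Defs where

open import Level using (Level; 0ℓ; suc; Setω) renaming (zero to lzero)
open import Algebra.Bundles using (IdempotentCommutativeMonoid)
open import Data.Product using (Σ; ∃; ∃-syntax; _×_; _,_; proj₁)
open import Data.Sum using (_⊎_)
open import Data.List using (List)
open import Data.List.Relation.Unary.All using (All)
open import Data.List.Relation.Unary.Any using (Any)
open import Relation.Nullary using (¬_)
open import Relation.Unary using (Pred; _∈_; _∉_; _⊆_; _≐_; _∩_; ∁; U)
open import Axiom.ExcludedMiddle using (ExcludedMiddle)

-- Classical metatheory (the paper works in ZFC).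

LEM : Setω
LEM = ∀ {ℓ} → ExcludedMiddle ℓ

IsChain : {A : Set} → Pred (Pred A 0ℓ) (suc 0ℓ) → Set (suc 0ℓ)
IsChain 𝒞 = ∀ C D → C ∈ 𝒞 → D ∈ 𝒞 → (C ⊆ D) ⊎ (D ⊆ C)

Zorn : Set (suc (suc 0ℓ))
Zorn = (A : Set) (𝓕 : Pred (Pred A 0ℓ) (suc 0ℓ)) →
       (∀ (𝒞 : Pred (Pred A 0ℓ) (suc 0ℓ)) → 𝒞 ⊆ 𝓕 → IsChain 𝒞 →
          ∃[ B ] (B ∈ 𝓕 × (∀ C → C ∈ 𝒞 → C ⊆ B))) →
       ∃[ M ] (M ∈ 𝓕 × (∀ N → N ∈ 𝓕 → M ⊆ N → N ⊆ M))

-- Semilattices ⟨A,∧,1⟩ = idempotent commutative monoids.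

module _ (𝐀 : IdempotentCommutativeMonoid 0ℓ 0ℓ) where
  open IdempotentCommutativeMonoid 𝐀 renaming (Carrier to A; _∙_ to _∧_; ε to 𝟏)

  _≤ₐ_ : A → A → Set
  a ≤ₐ b = (a ∧ b) ≈ a

  IsDistributive : Set
  IsDistributive = ∀ a b c → (a ∧ b) ≤ₐ c →
    ∃[ a₁ ] ∃[ b₁ ] (a ≤ₐ a₁ × b ≤ₐ b₁ × c ≈ (a₁ ∧ b₁))

  IsMonotone : (A → A) → Set
  IsMonotone m = ∀ a b → a ≤ₐ b → m a ≤ₐ m b

  IsFilter : Pred A 0ℓ → Set
  IsFilter F = (𝟏 ∈ F)
             × (∀ a b → a ∈ F → a ≤ₐ b → b ∈ F)
             × (∀ a b → a ∈ F → b ∈ F → (a ∧ b) ∈ F)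

  IsIrreducible : Pred A 0ℓ → Set _
  IsIrreducible F = IsFilter F
    × ¬ (∀ a → a ∈ F)
    × (∀ F₁ F₂ → IsFilter F₁ → IsFilter F₂ → F ≐ (F₁ ∩ F₂) → (F ≐ F₁) ⊎ (F ≐ F₂))

  X : Set (suc 0ℓ)
  X = Σ (Pred A 0ℓ) IsIrreducible

  filt : X → Pred A 0ℓ
  filt = proj₁

  β : A → Pred X 0ℓ
  β a P = a ∈ filt P

  -- Topology on X(A) generated by the subbasis {X − β(a) : a ∈ A}:
  -- U is open iff each point of U lies in a finite intersection of
  -- subbasic sets contained in U.
  IsOpen : Pred X 0ℓ → Set _
  IsOpen V = ∀ P → P ∈ V → ∃[ as ] (All (λ a → P ∈ ∁ (β a)) as ×
                   (∀ Q → All (λ a → Q ∈ ∁ (β a)) as → Q ∈ V))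

  IsCompact : Pred X 0ℓ → Set _
  IsCompact V = ∀ (𝒞 : Pred (Pred X 0ℓ) (suc 0ℓ)) → (∀ W → W ∈ 𝒞 → IsOpen W) →
    (∀ P → P ∈ V → ∃[ W ] (W ∈ 𝒞 × P ∈ W)) →
    ∃[ Ws ] (All (λ W → W ∈ 𝒞) Ws × (∀ P → P ∈ V → Any (λ W → P ∈ W) Ws))

  IsKO : Pred X 0ℓ → Set _
  IsKO V = IsOpen V × IsCompact V

  InD : Pred X 0ℓ → Set _
  InD V = IsKO (∁ V)

  IsDuallyDirected : Pred (Pred X 0ℓ) (suc 0ℓ) → Set _
  IsDuallyDirected ℒ = (∃[ V ] (V ∈ ℒ))
    × (∀ V₁ V₂ → V₁ ∈ ℒ → V₂ ∈ ℒ → ∃[ V₃ ] (V₃ ∈ ℒ × V₃ ⊆ V₁ × V₃ ⊆ V₂))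

  ⋂ : Pred (Pred X 0ℓ) (suc 0ℓ) → Pred X _
  ⋂ ℒ P = ∀ V → V ∈ ℒ → P ∈ V

  InS : Pred X (suc 0ℓ) → Set _
  InS Z = ∃[ ℒ ] (IsDuallyDirected ℒ × (∀ V → V ∈ ℒ → IsKO V) × Z ≐ ⋂ ℒ)

  module _ (m : A → A) where
    m⁻¹ : Pred A 0ℓ → Pred A 0ℓ
    m⁻¹ P a = m a ∈ P

    I : Pred X (suc 0ℓ) → Pred A (suc 0ℓ)
    I Z a = ∀ P → P ∈ β a → P ∈ Z → Data.Empty.⊥
      where import Data.Empty

    R : X → Pred X (suc 0ℓ) → Set (suc 0ℓ)
    R P Z = ¬ (∃[ a ] (a ∈ m⁻¹ (filt P) × a ∈ I Z))

    mR : Pred X 0ℓ → Pred X _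
    mR V P = ∀ Z → InS Z → R P Z → ∃[ Q ] (Q ∈ Z × Q ∈ V)

  IsMDSIsoOntoD : (A → A) → Set _
  IsMDSIsoOntoD m =
      (∀ a → InD (β a))
    × (∀ a b → β (a ∧ b) ≐ (β a ∩ β b))
    × (β 𝟏 ≐ U)
    × (∀ a → β (m a) ≐ mR m (β a))
    × (∀ a b → β a ≐ β b → a ≈ b)
    × (∀ V → InD V → ∃[ a ] (β a ≐ V))

-- The filter-theoretic half of the argument is Stone's: by Zorn's lemma
-- every filter avoiding a point extends to an irreducible filter avoiding
-- it, so β reflects the order and is injective.  Distributivity makes the
-- complement of an irreducible filter up-directed, whence the sets X − β(c)
-- form a basis of the topology; compactness of X − β(a) is again the prime
-- filter theorem, applied to the filter generated by the basic sets of a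
-- cover, and a compact open set is a finite union of basic sets, i.e.
-- X − β(c₁ ∧ ⋯ ∧ cₙ).  For the modal operator, β(m a) ⊆ m_{R_m}(β a) is
-- immediate, and the converse is witnessed by Z = X − β(a) ∈ 𝒮(X): a
-- point P with m a ∉ P is R_m-related to Z, because b ∈ I(Z) means
-- β(b) ⊆ β(a), i.e. b ≤ a, so m b ∉ P by monotonicity.
module Submission where

open import Defs
open import Level using (0ℓ; Lift; lift; lower) renaming (suc to lsuc)
open import Algebra.Bundles using (IdempotentCommutativeMonoid)
open import Axiom.DoubleNegationElimination using (em⇒dne)
open import Data.Product using (Σ; ∃-syntax; _×_; _,_; proj₁; proj₂)
open import Data.Sum using (_⊎_; inj₁; inj₂)
open import Data.List using (List; []; _∷_; _++_; foldr)
open import Data.List.Relation.Unary.All as All using (All; []; _∷_)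
open import Data.List.Relation.Unary.All.Properties using (++⁺)
open import Data.List.Relation.Unary.Any using (Any; here; there)
open import Data.Empty using (⊥-elim)
open import Data.Unit using (tt)
open import Function using (id)
open import Relation.Nullary using (¬_; yes; no)
open import Relation.Nullary.Decidable using (True; fromWitness; toWitness)
open import Relation.Unary using (Pred; _∈_; _∉_; _⊆_; _≐_; _∩_; ∁; U)
import Relation.Binary.PropositionalEquality as ≡
import Relation.Binary.Construct.NaturalOrder.Left as LeftNaturalOrder

module Classical (lem : LEM) where

  -- Propositional resizing, which excluded middle provides: filters are
  -- Set-valued, but the sets generated from chains and covers live in Set₁.
  Resize : ∀ {ℓ} → Set ℓ → Set
  Resize P = True (lem {P = P})

  resize : ∀ {ℓ} {P : Set ℓ} → P → Resize P
  resize = fromWitness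

  unresize : ∀ {ℓ} {P : Set ℓ} → Resize P → P
  unresize = toWitness

  ¬¬-elim : ∀ {ℓ} {P : Set ℓ} → ¬ ¬ P → P
  ¬¬-elim = em⇒dne lem

module SemilatticeTheory (𝐀 : IdempotentCommutativeMonoid 0ℓ 0ℓ) where
  open IdempotentCommutativeMonoid 𝐀 renaming (Carrier to A; _∙_ to _∧_; ε to 𝟏)
  private module L = LeftNaturalOrder _≈_ _∧_

  -- The library's natural order is x ≈ x ∧ y; ours is its symmetric form.
  _≤_ : A → A → Set
  _≤_ = _≤ₐ_ 𝐀

  ≤-refl : ∀ {a} → a ≤ a
  ≤-refl {a} = idem a

  ≤-reflexive : ∀ {a b} → a ≈ b → a ≤ b
  ≤-reflexive a≈b = sym (L.reflexive isMagma idem a≈b)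

  ≤-trans : ∀ {a b c} → a ≤ b → b ≤ c → a ≤ c
  ≤-trans a≤b b≤c = sym (L.trans isSemigroup (sym a≤b) (sym b≤c))

  ≤-antisym : ∀ {a b} → a ≤ b → b ≤ a → a ≈ b
  ≤-antisym a≤b b≤a = L.antisym isEquivalence comm (sym a≤b) (sym b≤a)

  x≤𝟏 : ∀ {a} → a ≤ 𝟏
  x≤𝟏 {a} = identityʳ a

  x∧y≤x : ∀ {a b} → (a ∧ b) ≤ a
  x∧y≤x {a} {b} = sym (L.x∙y≤x isCommutativeBand a b)

  x∧y≤y : ∀ {a b} → (a ∧ b) ≤ b
  x∧y≤y {a} {b} = sym (L.x∙y≤y isCommutativeBand a b)

  ∧-glb : ∀ {x a b} → x ≤ a → x ≤ b → x ≤ (a ∧ b)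
  ∧-glb x≤a x≤b = sym (L.∙-presʳ-≤ isCommutativeBand _ (sym x≤a) (sym x≤b))

  ∧-mono : ∀ {a b c d} → a ≤ c → b ≤ d → (a ∧ b) ≤ (c ∧ d)
  ∧-mono a≤c b≤d = ∧-glb (≤-trans x∧y≤x a≤c) (≤-trans x∧y≤y b≤d)

  ⋀ : List A → A
  ⋀ = foldr _∧_ 𝟏

  ⋀-++ : ∀ cs ds → ⋀ (cs ++ ds) ≈ (⋀ cs ∧ ⋀ ds)
  ⋀-++ []       ds = sym (identityˡ (⋀ ds))
  ⋀-++ (c ∷ cs) ds = trans (∙-cong refl (⋀-++ cs ds)) (sym (assoc c (⋀ cs) (⋀ ds)))

  module _ {F : Pred A 0ℓ} (isF : IsFilter 𝐀 F) where

    filter-𝟏 : 𝟏 ∈ F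
    filter-𝟏 = proj₁ isF

    filter-↑ : ∀ {a b} → a ∈ F → a ≤ b → b ∈ F
    filter-↑ = proj₁ (proj₂ isF) _ _

    filter-∧ : ∀ {a b} → a ∈ F → b ∈ F → (a ∧ b) ∈ F
    filter-∧ = proj₂ (proj₂ isF) _ _

  point-isFilter : (P : X 𝐀) → IsFilter 𝐀 (filt 𝐀 P)
  point-isFilter P = proj₁ (proj₂ P)

  ↑-isFilter : ∀ a → IsFilter 𝐀 (a ≤_)
  ↑-isFilter a = x≤𝟏 , (λ _ _ → ≤-trans) , (λ _ _ → ∧-glb)

  β-∧ : ∀ a b → β 𝐀 (a ∧ b) ≐ (β 𝐀 a ∩ β 𝐀 b)
  β-∧ a b = (λ {P} a∧b∈P → filter-↑ (point-isFilter P) a∧b∈P x∧y≤x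
                          , filter-↑ (point-isFilter P) a∧b∈P x∧y≤y)
          , (λ {P} (a∈P , b∈P) → filter-∧ (point-isFilter P) a∈P b∈P)

  β-𝟏 : β 𝐀 𝟏 ≐ U
  β-𝟏 = (λ _ → tt) , (λ {P} _ → filter-𝟏 (point-isFilter P))

  adjoin : Pred A 0ℓ → A → Pred A 0ℓ
  adjoin F e x = ∃[ p ] (p ∈ F × (p ∧ e) ≤ x)

  module _ {F : Pred A 0ℓ} (isF : IsFilter 𝐀 F) (e : A) where

    adjoin-isFilter : IsFilter 𝐀 (adjoin F e)
    adjoin-isFilter =
        (𝟏 , filter-𝟏 isF , x≤𝟏)
      , (λ _ _ (p , p∈F , p∧e≤x) x≤y → p , p∈F , ≤-trans p∧e≤x x≤y)
      , (λ _ _ (p , p∈F , p∧e≤x) (q , q∈F , q∧e≤y) →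
           (p ∧ q) , filter-∧ isF p∈F q∈F
         , ∧-glb (≤-trans (∧-mono x∧y≤x ≤-refl) p∧e≤x)
                 (≤-trans (∧-mono x∧y≤y ≤-refl) q∧e≤y))

    ⊆-adjoin : F ⊆ adjoin F e
    ⊆-adjoin p∈F = _ , p∈F , x∧y≤x

    ∈-adjoin : e ∈ adjoin F e
    ∈-adjoin = 𝟏 , filter-𝟏 isF , x∧y≤y

  KO⇒InS : ∀ {V} → IsKO 𝐀 V → InS 𝐀 (λ P → Lift (lsuc 0ℓ) (P ∈ V))
  KO⇒InS {V} V-isKO =
      (V ≡.≡_)
    , ((V , ≡.refl) , λ { _ _ ≡.refl ≡.refl → V , ≡.refl , id , id })
    , (λ { _ ≡.refl → V-isKO })
    , (λ { (lift P∈V) _ ≡.refl → P∈V }) , (λ P∈⋂ → lift (P∈⋂ V ≡.refl))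

module PrimeFilters (lem : LEM) (zorn : Zorn) (𝐀 : IdempotentCommutativeMonoid 0ℓ 0ℓ) where
  open IdempotentCommutativeMonoid 𝐀 using (_≈_) renaming (Carrier to A; _∙_ to _∧_)
  open Classical lem
  open SemilatticeTheory 𝐀

  module _ {F : Pred A 0ℓ} (isF : IsFilter 𝐀 F) {a : A} (a∉F : a ∉ F) where

    Avoiding : Pred (Pred A 0ℓ) (lsuc 0ℓ)
    Avoiding H = Lift (lsuc 0ℓ) (IsFilter 𝐀 H × F ⊆ H × a ∉ H)

    chain-bounded : ∀ 𝒞 → 𝒞 ⊆ Avoiding → IsChain 𝒞 →
                    ∃[ B ] (B ∈ Avoiding × (∀ C → C ∈ 𝒞 → C ⊆ B))
    chain-bounded 𝒞 𝒞⊆Avoiding chain =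
      B , lift (B-isFilter , (λ x∈F → resize (inj₁ x∈F)) , a∉B) , λ C C∈𝒞 x∈C → resize (inj₂ (C , C∈𝒞 , x∈C))
      where
      B : Pred A 0ℓ
      B x = Resize (x ∈ F ⊎ ∃[ C ] (C ∈ 𝒞 × x ∈ C))

      member : ∀ {C} → C ∈ 𝒞 → IsFilter 𝐀 C × F ⊆ C × a ∉ C
      member C∈𝒞 = lower (𝒞⊆Avoiding C∈𝒞)

      ∈B-∧ : ∀ {C x y} → C ∈ 𝒞 → x ∈ C → y ∈ C → (x ∧ y) ∈ B
      ∈B-∧ {C} C∈𝒞 x∈C y∈C = resize (inj₂ (C , C∈𝒞 , filter-∧ (proj₁ (member C∈𝒞)) x∈C y∈C))

      B-∧ : ∀ x y → x ∈ B → y ∈ B → (x ∧ y) ∈ B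
      B-∧ x y x∈B y∈B with unresize x∈B | unresize y∈B
      ... | inj₁ x∈F | inj₁ y∈F = resize (inj₁ (filter-∧ isF x∈F y∈F))
      ... | inj₁ x∈F | inj₂ (C , C∈𝒞 , y∈C) = ∈B-∧ C∈𝒞 (proj₁ (proj₂ (member C∈𝒞)) x∈F) y∈C
      ... | inj₂ (C , C∈𝒞 , x∈C) | inj₁ y∈F = ∈B-∧ C∈𝒞 x∈C (proj₁ (proj₂ (member C∈𝒞)) y∈F)
      ... | inj₂ (C , C∈𝒞 , x∈C) | inj₂ (D , D∈𝒞 , y∈D) with chain C D C∈𝒞 D∈𝒞
      ...   | inj₁ C⊆D = ∈B-∧ D∈𝒞 (C⊆D x∈C) y∈D
      ...   | inj₂ D⊆C = ∈B-∧ C∈𝒞 x∈C (D⊆C y∈D)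

      B-↑ : ∀ x y → x ∈ B → x ≤ y → y ∈ B
      B-↑ x y x∈B x≤y with unresize x∈B
      ... | inj₁ x∈F = resize (inj₁ (filter-↑ isF x∈F x≤y))
      ... | inj₂ (C , C∈𝒞 , x∈C) = resize (inj₂ (C , C∈𝒞 , filter-↑ (proj₁ (member C∈𝒞)) x∈C x≤y))

      B-isFilter : IsFilter 𝐀 B
      B-isFilter = resize (inj₁ (filter-𝟏 isF)) , B-↑ , B-∧

      a∉B : a ∉ B
      a∉B a∈B with unresize a∈B
      ... | inj₁ a∈F = a∉F a∈F
      ... | inj₂ (C , C∈𝒞 , a∈C) = proj₂ (proj₂ (member C∈𝒞)) a∈C

    -- If M = F₁ ∩ F₂ then a is missed by some Fᵢ, which is then a member of
    -- Avoiding above M and hence equal to M.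
    maximal-isIrreducible : ∀ {M} → M ∈ Avoiding →
                            (∀ N → N ∈ Avoiding → M ⊆ N → N ⊆ M) → IsIrreducible 𝐀 M
    maximal-isIrreducible {M} (lift (M-isFilter , F⊆M , a∉M)) maximal =
      M-isFilter , (λ all∈M → a∉M (all∈M a)) , split
      where
      split : ∀ F₁ F₂ → IsFilter 𝐀 F₁ → IsFilter 𝐀 F₂ → M ≐ (F₁ ∩ F₂) → (M ≐ F₁) ⊎ (M ≐ F₂)
      split F₁ F₂ isF₁ isF₂ (M⊆F₁∩F₂ , F₁∩F₂⊆M) with lem {P = a ∈ F₁} | lem {P = a ∈ F₂}
      ... | no a∉F₁ | _ =
        inj₁ (M⊆F₁ , maximal F₁ (lift (isF₁ , (λ x∈F → M⊆F₁ (F⊆M x∈F)) , a∉F₁)) M⊆F₁)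
        where M⊆F₁ = λ {x} x∈M → proj₁ (M⊆F₁∩F₂ {x} x∈M)
      ... | yes _ | no a∉F₂ =
        inj₂ (M⊆F₂ , maximal F₂ (lift (isF₂ , (λ x∈F → M⊆F₂ (F⊆M x∈F)) , a∉F₂)) M⊆F₂)
        where M⊆F₂ = λ {x} x∈M → proj₂ (M⊆F₁∩F₂ {x} x∈M)
      ... | yes a∈F₁ | yes a∈F₂ = ⊥-elim (a∉M (F₁∩F₂⊆M (a∈F₁ , a∈F₂)))

    separate : Σ (X 𝐀) λ P → F ⊆ filt 𝐀 P × a ∉ filt 𝐀 P
    separate with zorn A Avoiding chain-bounded
    ... | M , M∈Avoiding@(lift (_ , F⊆M , a∉M)) , maximal =
      (M , maximal-isIrreducible M∈Avoiding maximal) , F⊆M , a∉M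

  β-reflects-≤ : ∀ {a b} → β 𝐀 a ⊆ β 𝐀 b → a ≤ b
  β-reflects-≤ {a} {b} βa⊆βb = ¬¬-elim λ a≰b → refute (separate (↑-isFilter a) a≰b)
    where
    refute : ¬ (Σ (X 𝐀) λ P → (a ≤_) ⊆ filt 𝐀 P × b ∉ filt 𝐀 P)
    refute (P , ↑a⊆P , b∉P) = b∉P (βa⊆βb {P} (↑a⊆P ≤-refl))

  β-injective : ∀ a b → β 𝐀 a ≐ β 𝐀 b → a ≈ b
  β-injective a b (βa⊆βb , βb⊆βa) =
    ≤-antisym (β-reflects-≤ (λ {P} → βa⊆βb {P})) (β-reflects-≤ (λ {P} → βb⊆βa {P}))

module DistributiveSemilattice (𝐀 : IdempotentCommutativeMonoid 0ℓ 0ℓ) (dist : IsDistributive 𝐀) where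
  open IdempotentCommutativeMonoid 𝐀 using (sym)
  open SemilatticeTheory 𝐀

  -- Distributivity writes x = p' ∧ a' with a' ≥ a, and then a' = q' ∧ b'
  -- with b' ≥ b; as b' ≥ a' ≥ a, b' is a common upper bound, so it lies in F.
  adjoin-∩-⊆ : ∀ {F} → IsFilter 𝐀 F → ∀ {a b} → (∀ c → a ≤ c → b ≤ c → c ∈ F) →
               (adjoin F a ∩ adjoin F b) ⊆ F
  adjoin-∩-⊆ {F} isF {a} {b} bounds∈F {x} ((p , p∈F , p∧a≤x) , (q , q∈F , q∧b≤x))
    with dist p a x p∧a≤x
  ... | p' , a' , p≤p' , a≤a' , x≈p'∧a'
    with dist q b a' (≤-trans q∧b≤x (≤-trans (≤-reflexive x≈p'∧a') x∧y≤y))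
  ... | q' , b' , q≤q' , b≤b' , a'≈q'∧b' =
    filter-↑ isF (filter-∧ isF (filter-↑ isF p∈F p≤p') a'∈F) (≤-reflexive (sym x≈p'∧a'))
    where
    b'∈F : b' ∈ F
    b'∈F = bounds∈F b' (≤-trans a≤a' (≤-trans (≤-reflexive a'≈q'∧b') x∧y≤y)) b≤b'

    a'∈F : a' ∈ F
    a'∈F = filter-↑ isF (filter-∧ isF (filter-↑ isF q∈F q≤q') b'∈F) (≤-reflexive (sym a'≈q'∧b'))

module IrreducibleFilters (lem : LEM) (𝐀 : IdempotentCommutativeMonoid 0ℓ 0ℓ)
                          (dist : IsDistributive 𝐀) where
  open Classical lem
  open SemilatticeTheory 𝐀
  open DistributiveSemilattice 𝐀 dist

  module _ (P : X 𝐀) where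
    private
      isP : IsFilter 𝐀 (filt 𝐀 P)
      isP = point-isFilter P

    complement-directed : ∀ {a b} → a ∉ filt 𝐀 P → b ∉ filt 𝐀 P →
                          ∃[ c ] (c ∉ filt 𝐀 P × a ≤ c × b ≤ c)
    complement-directed {a} {b} a∉P b∉P = ¬¬-elim λ noBound →
      refute (proj₂ (proj₂ (proj₂ P)) (adjoin (filt 𝐀 P) a) (adjoin (filt 𝐀 P) b)
                (adjoin-isFilter isP a) (adjoin-isFilter isP b)
                ( (λ x∈P → ⊆-adjoin isP a x∈P , ⊆-adjoin isP b x∈P)
                , adjoin-∩-⊆ isP (λ c a≤c b≤c → ¬¬-elim λ c∉P → noBound (c , c∉P , a≤c , b≤c))))
      where
      refute : ¬ ((filt 𝐀 P ≐ adjoin (filt 𝐀 P) a) ⊎ (filt 𝐀 P ≐ adjoin (filt 𝐀 P) b))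
      refute (inj₁ (_ , adjoin⊆P)) = a∉P (adjoin⊆P (∈-adjoin isP a))
      refute (inj₂ (_ , adjoin⊆P)) = b∉P (adjoin⊆P (∈-adjoin isP b))

    complement-nonempty : ∃[ c ] (c ∉ filt 𝐀 P)
    complement-nonempty = ¬¬-elim λ empty →
      proj₁ (proj₂ (proj₂ P)) λ x → ¬¬-elim λ x∉P → empty (x , x∉P)

    complement-upperBound : ∀ {as} → All (_∉ filt 𝐀 P) as →
                            ∃[ c ] (c ∉ filt 𝐀 P × All (_≤ c) as)
    complement-upperBound [] = let (c , c∉P) = complement-nonempty in c , c∉P , []
    complement-upperBound (a∉P ∷ as∉P) with complement-upperBound as∉P
    ... | c , c∉P , as≤c with complement-directed a∉P c∉P
    ...   | d , d∉P , a≤d , c≤d = d , d∉P , a≤d ∷ All.map (λ x≤c → ≤-trans x≤c c≤d) as≤c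

module Spectrum (lem : LEM) (zorn : Zorn) (𝐀 : IdempotentCommutativeMonoid 0ℓ 0ℓ)
                (dist : IsDistributive 𝐀) where
  open IdempotentCommutativeMonoid 𝐀 using () renaming (Carrier to A; _∙_ to _∧_; ε to 𝟏)
  open Classical lem
  open SemilatticeTheory 𝐀
  open PrimeFilters lem zorn 𝐀
  open IrreducibleFilters lem 𝐀 dist

  ∁β-isOpen : ∀ c → IsOpen 𝐀 (∁ (β 𝐀 c))
  ∁β-isOpen c P c∉P = (c ∷ []) , (c∉P ∷ []) , λ { Q (c∉Q ∷ []) → c∉Q }

  basic-neighbourhood : ∀ {W} → IsOpen 𝐀 W → ∀ P → P ∈ W →
                        ∃[ c ] (c ∉ filt 𝐀 P × ∁ (β 𝐀 c) ⊆ W)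
  basic-neighbourhood W-open P P∈W with W-open P P∈W
  ... | as , as∉P , W⊇ with complement-upperBound P as∉P
  ...   | c , c∉P , as≤c = c , c∉P , λ {Q} c∉Q →
    W⊇ Q (All.map (λ a≤c a∈Q → c∉Q (filter-↑ (point-isFilter Q) a∈Q a≤c)) as≤c)

  generated : ∀ {ℓ} → Pred A ℓ → Pred A 0ℓ
  generated S d = Resize (∃[ cs ] (All S cs × ⋀ cs ≤ d))

  generated-isFilter : ∀ {ℓ} (S : Pred A ℓ) → IsFilter 𝐀 (generated S)
  generated-isFilter S = resize ([] , [] , ≤-refl) , upward , meet
    where
    upward : ∀ x y → x ∈ generated S → x ≤ y → y ∈ generated S
    upward x y x∈G x≤y with unresize x∈G
    ... | cs , cs∈S , ⋀cs≤x = resize (cs , cs∈S , ≤-trans ⋀cs≤x x≤y)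

    meet : ∀ x y → x ∈ generated S → y ∈ generated S → (x ∧ y) ∈ generated S
    meet x y x∈G y∈G with unresize x∈G | unresize y∈G
    ... | cs , cs∈S , ⋀cs≤x | ds , ds∈S , ⋀ds≤y =
      resize ((cs ++ ds) , ++⁺ cs∈S ds∈S , ≤-trans (≤-reflexive (⋀-++ cs ds)) (∧-mono ⋀cs≤x ⋀ds≤y))

  module _ (𝒞 : Pred (Pred (X 𝐀) 0ℓ) (lsuc 0ℓ)) where

    BasicInside : Pred A (lsuc 0ℓ)
    BasicInside c = ∃[ W ] (W ∈ 𝒞 × ∁ (β 𝐀 c) ⊆ W)

    finite-subcover : ∀ {cs} → All BasicInside cs →
      ∃[ Ws ] (All (_∈ 𝒞) Ws × (∀ P → ⋀ cs ∉ filt 𝐀 P → Any (P ∈_) Ws))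
    finite-subcover [] = [] , [] , λ P 𝟏∉P → ⊥-elim (𝟏∉P (filter-𝟏 (point-isFilter P)))
    finite-subcover {c ∷ cs} ((W , W∈𝒞 , ∁βc⊆W) ∷ cs-basic) with finite-subcover cs-basic
    ... | Ws , Ws∈𝒞 , covers = (W ∷ Ws) , (W∈𝒞 ∷ Ws∈𝒞) , cover
      where
      cover : ∀ P → (c ∧ ⋀ cs) ∉ filt 𝐀 P → Any (P ∈_) (W ∷ Ws)
      cover P c∧⋀cs∉P with lem {P = c ∈ filt 𝐀 P}
      ... | no c∉P = here (∁βc⊆W c∉P)
      ... | yes c∈P = there (covers P λ ⋀cs∈P → c∧⋀cs∉P (filter-∧ (point-isFilter P) c∈P ⋀cs∈P))

  ∁β-isCompact : ∀ a → IsCompact 𝐀 (∁ (β 𝐀 a))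
  ∁β-isCompact a 𝒞 𝒞-open 𝒞-covers = subcover (¬¬-elim finitely-below-a)
    where
    -- Otherwise the filter generated by the basic sets inside 𝒞 extends to a
    -- point P ∉ β a; a basic neighbourhood X − β c ⊆ W ∈ 𝒞 of P gives c ∉ P,
    -- although c lies in that generated filter.
    finitely-below-a : ¬ ¬ (∃[ cs ] (All (BasicInside 𝒞) cs × ⋀ cs ≤ a))
    finitely-below-a none =
      refute (separate (generated-isFilter (BasicInside 𝒞)) (λ a∈G → none (unresize a∈G)))
      where
      refute : ¬ (Σ (X 𝐀) λ P → generated (BasicInside 𝒞) ⊆ filt 𝐀 P × a ∉ filt 𝐀 P)
      refute (P , G⊆P , a∉P) with 𝒞-covers P a∉P
      ... | W , W∈𝒞 , P∈W with basic-neighbourhood (𝒞-open W W∈𝒞) P P∈W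
      ...   | c , c∉P , ∁βc⊆W = c∉P (G⊆P (resize ((c ∷ []) , ((W , W∈𝒞 , ∁βc⊆W) ∷ []) , x∧y≤x)))

    subcover : ∃[ cs ] (All (BasicInside 𝒞) cs × ⋀ cs ≤ a) →
               ∃[ Ws ] (All (_∈ 𝒞) Ws × (∀ P → P ∈ ∁ (β 𝐀 a) → Any (P ∈_) Ws))
    subcover (cs , cs-basic , ⋀cs≤a) with finite-subcover 𝒞 cs-basic
    ... | Ws , Ws∈𝒞 , covers =
      Ws , Ws∈𝒞 , λ P a∉P → covers P (λ ⋀cs∈P → a∉P (filter-↑ (point-isFilter P) ⋀cs∈P ⋀cs≤a))

  β-inD : ∀ a → InD 𝐀 (β 𝐀 a)
  β-inD a = ∁β-isOpen a , ∁β-isCompact a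

  module _ (V : Pred (X 𝐀) 0ℓ) where

    BasicOutside : Pred (Pred (X 𝐀) 0ℓ) (lsuc 0ℓ)
    BasicOutside W = ∃[ c ] (W ≡.≡ ∁ (β 𝐀 c) × ∁ (β 𝐀 c) ⊆ ∁ V)

    basicCover-meet : ∀ {Ws} → All BasicOutside Ws →
      ∃[ c ] ((∀ P → Any (P ∈_) Ws → c ∉ filt 𝐀 P) × (∀ P → c ∉ filt 𝐀 P → P ∉ V))
    basicCover-meet [] = 𝟏 , (λ P ()) , λ P 𝟏∉P → ⊥-elim (𝟏∉P (filter-𝟏 (point-isFilter P)))
    basicCover-meet ((c , ≡.refl , ∁βc⊆∁V) ∷ Ws-basic) with basicCover-meet Ws-basic
    ... | d , covered⇒d∉ , d∉⇒∉V = (c ∧ d) , covered⇒c∧d∉ , c∧d∉⇒∉V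
      where
      covered⇒c∧d∉ : ∀ P → Any (P ∈_) (∁ (β 𝐀 c) ∷ _) → (c ∧ d) ∉ filt 𝐀 P
      covered⇒c∧d∉ P (here c∉P)      c∧d∈P = c∉P (filter-↑ (point-isFilter P) c∧d∈P x∧y≤x)
      covered⇒c∧d∉ P (there covered) c∧d∈P = covered⇒d∉ P covered (filter-↑ (point-isFilter P) c∧d∈P x∧y≤y)

      c∧d∉⇒∉V : ∀ P → (c ∧ d) ∉ filt 𝐀 P → P ∉ V
      c∧d∉⇒∉V P c∧d∉P with lem {P = c ∈ filt 𝐀 P}
      ... | no c∉P = ∁βc⊆∁V c∉P
      ... | yes c∈P = d∉⇒∉V P (λ d∈P → c∧d∉P (filter-∧ (point-isFilter P) c∈P d∈P))

  β-onto : ∀ V → InD 𝐀 V → ∃[ a ] (β 𝐀 a ≐ V)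
  β-onto V (∁V-open , ∁V-compact) with ∁V-compact (BasicOutside V) basic-isOpen basic-covers
    where
    basic-isOpen : ∀ W → W ∈ BasicOutside V → IsOpen 𝐀 W
    basic-isOpen _ (c , ≡.refl , _) = ∁β-isOpen c

    basic-covers : ∀ P → P ∈ ∁ V → ∃[ W ] (W ∈ BasicOutside V × P ∈ W)
    basic-covers P P∉V with basic-neighbourhood ∁V-open P P∉V
    ... | c , c∉P , ∁βc⊆∁V = ∁ (β 𝐀 c) , (c , ≡.refl , ∁βc⊆∁V) , c∉P
  ... | Ws , Ws-basic , covers with basicCover-meet V Ws-basic
  ...   | c , covered⇒c∉ , c∉⇒∉V =
    c , (λ {P} c∈P → ¬¬-elim λ P∉V → covered⇒c∉ P (covers P P∉V) c∈P)
      , (λ {P} P∈V → ¬¬-elim λ c∉P → c∉⇒∉V P c∉P P∈V)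

module MonotoneOperator (lem : LEM) (zorn : Zorn) (𝐀 : IdempotentCommutativeMonoid 0ℓ 0ℓ)
    (dist : IsDistributive 𝐀) (m : IdempotentCommutativeMonoid.Carrier 𝐀 → IdempotentCommutativeMonoid.Carrier 𝐀)
    (mono : IsMonotone 𝐀 m) where
  open Classical lem
  open SemilatticeTheory 𝐀
  open PrimeFilters lem zorn 𝐀
  open Spectrum lem zorn 𝐀 dist

  β-m : ∀ a → β 𝐀 (m a) ≐ mR 𝐀 m (β 𝐀 a)
  β-m a = (λ {P} → β-m⊆mR {P}) , (λ {P} → mR⊆β-m {P})
    where
    β-m⊆mR : β 𝐀 (m a) ⊆ mR 𝐀 m (β 𝐀 a)
    β-m⊆mR {P} ma∈P Z _ PRZ = ¬¬-elim λ Z∩βa-empty →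
      PRZ (a , ma∈P , λ Q a∈Q Q∈Z → Z∩βa-empty (Q , Q∈Z , a∈Q))

    Zₐ : Pred (X 𝐀) (lsuc 0ℓ)
    Zₐ P = Lift (lsuc 0ℓ) (P ∈ ∁ (β 𝐀 a))

    Zₐ∩βa-empty : ¬ (∃[ Q ] (Q ∈ Zₐ × Q ∈ β 𝐀 a))
    Zₐ∩βa-empty (Q , lift a∉Q , a∈Q) = a∉Q a∈Q

    R-Zₐ : ∀ P → m a ∉ filt 𝐀 P → R 𝐀 m P Zₐ
    R-Zₐ P ma∉P (b , mb∈P , b∈IZₐ) = ma∉P (filter-↑ (point-isFilter P) mb∈P (mono b a b≤a))
      where
      b≤a : b ≤ a
      b≤a = β-reflects-≤ λ {Q} b∈Q → ¬¬-elim λ a∉Q → b∈IZₐ Q b∈Q (lift a∉Q)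

    mR⊆β-m : mR 𝐀 m (β 𝐀 a) ⊆ β 𝐀 (m a)
    mR⊆β-m {P} P∈mR = ¬¬-elim λ ma∉P → Zₐ∩βa-empty (P∈mR Zₐ (KO⇒InS (β-inD a)) (R-Zₐ P ma∉P))

mainTheorem9 : LEM → Zorn →
    (𝐀 : IdempotentCommutativeMonoid 0ℓ 0ℓ) → IsDistributive 𝐀 →
    (m : IdempotentCommutativeMonoid.Carrier 𝐀 → IdempotentCommutativeMonoid.Carrier 𝐀) →
    IsMonotone 𝐀 m → IsMDSIsoOntoD 𝐀 m
mainTheorem9 lem zorn 𝐀 dist m mono = β-inD , β-∧ , β-𝟏 , β-m , β-injective , β-onto
  where
  open SemilatticeTheory 𝐀
  open PrimeFilters lem zorn 𝐀
  open Spectrum lem zorn 𝐀 dist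
  open MonotoneOperator lem zorn 𝐀 dist m mono
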